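{- Let $p$ be a prime and $r\geq 1$ an integer. Let $A=\sum_{i=0}^{r}a_ip^i$ and $B=\sum_{i=0}^{r}b_ip^i$ with $a_i,b_i\in\{0,1,\ldots,p-1\}$, and write $A+B=\sum_{i=0}^{r+1}c_ip^i$ with $c_i\in\{0,1,\ldots,p-1\}$. Put $a_{r+1}=b_{r+1}=0$. Then $c_0\equiv a_0+b_0 \pmod p$, and for every $1\leq t\leq r+1$, $$c_t\equiv a_t+b_t+\sum_{i=0}^{t-1}\left(\sum_{k=1}^{p-1}\binom{a_i}{k}\binom{b_i}{p-k}\right)\prod_{j=i+1}^{t-1}\binom{a_j+b_j}{p-1}\pmod p.$$
   Context: Binomial coefficients $\binom{n}{k}$ are the usual ones for non-negative integers $n,k$ (equal to $0$ when $k>n$). An empty product equals $1$. -}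

module Defs where

open import Data.Nat using (ℕ; zero; suc; _+_; _*_; _^_; _∸_)
open import Data.Nat.Combinatorics using (_C_)

sumTo : ℕ → (ℕ → ℕ) → ℕ
sumTo zero    f = 0
sumTo (suc n) f = sumTo n f + f n

prodTo : ℕ → (ℕ → ℕ) → ℕ
prodTo zero    f = 1
prodTo (suc n) f = prodTo n f * f n

digitValue : ℕ → ℕ → (ℕ → ℕ) → ℕ
digitValue p n d = sumTo n (λ i → d i * p ^ i)

-- Σ_{k=1}^{p-1} C(a,k) C(b,p-k)
carryTerm : ℕ → ℕ → ℕ → ℕ
carryTerm p a b = sumTo (p ∸ 1) (λ k → (a C suc k) * (b C (p ∸ suc k)))

-- Π_{j=i+1}^{t-1} C(a_j + b_j, p-1)  (empty product = 1 when i+1 > t-1)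
carryProd : ℕ → (ℕ → ℕ) → (ℕ → ℕ) → ℕ → ℕ → ℕ
carryProd p a b i t =
  prodTo (t ∸ suc i) (λ m → (a (suc i + m) + b (suc i + m)) C (p ∸ 1))

rhs : ℕ → (ℕ → ℕ) → (ℕ → ℕ) → ℕ → ℕ
rhs p a b t = a t + b t
  + sumTo t (λ i → carryTerm p (a i) (b i) * carryProd p a b i t)

{-# OPTIONS --safe #-}
-- Adding digit by digit, c_t ≡ κ_t + a_t + b_t (mod p), where the carries
-- κ_0 = 0, κ_{t+1} = ⌊(κ_t + a_t + b_t)/p⌋ lie in {0,1}.  By Vandermonde the
-- inner sum over k is C(a_t+b_t, p), which mod p is ⌊(a_t+b_t)/p⌋, the carry
-- produced without an incoming one; and C(a_t+b_t, p-1) ≡ 1 exactly when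
-- a_t + b_t = p-1, the case in which an incoming carry is passed on, and ≡ 0
-- otherwise.  So κ_{t+1} ≡ C(a_t+b_t, p) + κ_t C(a_t+b_t, p-1) (mod p), and
-- unrolling this linear recurrence gives the sum in the theorem.
module Submission where

open import Defs
open import Data.Nat
open import Data.Nat.Combinatorics
open import Data.Nat.Divisibility
open import Data.Nat.DivMod
open import Data.Nat.Primality
open import Data.Nat.Properties
open import Data.Nat.Tactic.RingSolver using (solve-∀)
open import Data.Product using (_×_; _,_)
open import Data.Sum using (inj₁; inj₂)
open import Data.Empty using (⊥-elim)
open import Function using (_∘_)
open import Relation.Binary.Definitions using (tri<; tri≈; tri>)
open import Relation.Binary.PropositionalEquality
open import Relation.Nullary using (¬_; yes; no)

sumTo-cong : ∀ n {f g : ℕ → ℕ} → (∀ i → i < n → f i ≡ g i) → sumTo n f ≡ sumTo n g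
sumTo-cong zero    f≗g = refl
sumTo-cong (suc n) f≗g =
  cong₂ _+_ (sumTo-cong n (λ i i<n → f≗g i (m<n⇒m<1+n i<n))) (f≗g n ≤-refl)

sumTo-unfoldˡ : ∀ n (f : ℕ → ℕ) → sumTo (suc n) f ≡ f 0 + sumTo n (f ∘ suc)
sumTo-unfoldˡ zero    f = +-comm 0 (f 0)
sumTo-unfoldˡ (suc n) f = trans (cong (_+ f (suc n)) (sumTo-unfoldˡ n f)) (+-assoc (f 0) _ _)

sumTo-zero : ∀ n → sumTo n (λ _ → 0) ≡ 0
sumTo-zero zero    = refl
sumTo-zero (suc n) = trans (+-identityʳ _) (sumTo-zero n)

sumTo-distrib-+ : ∀ n (f g : ℕ → ℕ) → sumTo n (λ i → f i + g i) ≡ sumTo n f + sumTo n g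
sumTo-distrib-+ zero    f g = refl
sumTo-distrib-+ (suc n) f g =
  trans (cong (_+ (f n + g n)) (sumTo-distrib-+ n f g)) (interchange (sumTo n f) (sumTo n g) (f n) (g n))
  where
  interchange : ∀ w x y z → (w + x) + (y + z) ≡ (w + y) + (x + z)
  interchange = solve-∀

sumTo-distribʳ-* : ∀ n x (f : ℕ → ℕ) → sumTo n (λ i → f i * x) ≡ sumTo n f * x
sumTo-distribʳ-* zero    x f = refl
sumTo-distribʳ-* (suc n) x f =
  trans (cong (_+ f n * x) (sumTo-distribʳ-* n x f)) (sym (*-distribʳ-+ x (sumTo n f) (f n)))

binomialConvolution : ℕ → ℕ → ℕ → ℕ
binomialConvolution a b m = sumTo (suc m) (λ k → (a C k) * (b C (m ∸ k)))

binomialConvolution-pascal : ∀ a b m →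
  binomialConvolution (suc a) b (suc m) ≡ binomialConvolution a b (suc m) + binomialConvolution a b m
binomialConvolution-pascal a b m = begin
  binomialConvolution (suc a) b (suc m)
    ≡⟨ sumTo-unfoldˡ (suc m) _ ⟩
  1 * (b C suc m) + sumTo (suc m) (λ j → (suc a C suc j) * (b C (m ∸ j)))
    ≡⟨ cong (1 * (b C suc m) +_) (sumTo-cong (suc m) (λ j _ → pascal j)) ⟩
  1 * (b C suc m) + sumTo (suc m) (λ j → (a C j) * (b C (m ∸ j)) + (a C suc j) * (b C (m ∸ j)))
    ≡⟨ cong (1 * (b C suc m) +_) (sumTo-distrib-+ (suc m) _ _) ⟩
  1 * (b C suc m) + (binomialConvolution a b m + sumTo (suc m) (λ j → (a C suc j) * (b C (m ∸ j))))
    ≡⟨ swap (1 * (b C suc m)) (binomialConvolution a b m) _ ⟩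
  (1 * (b C suc m) + sumTo (suc m) (λ j → (a C suc j) * (b C (m ∸ j)))) + binomialConvolution a b m
    ≡⟨ cong (_+ binomialConvolution a b m) (sym (sumTo-unfoldˡ (suc m) (λ k → (a C k) * (b C (suc m ∸ k))))) ⟩
  binomialConvolution a b (suc m) + binomialConvolution a b m ∎
  where
  open ≡-Reasoning
  pascal : ∀ j → (suc a C suc j) * (b C (m ∸ j)) ≡ (a C j) * (b C (m ∸ j)) + (a C suc j) * (b C (m ∸ j))
  pascal j = trans (cong (_* (b C (m ∸ j))) (sym (nCk+nC[k+1]≡[n+1]C[k+1] a j)))
                   (*-distribʳ-+ (b C (m ∸ j)) (a C j) (a C suc j))
  swap : ∀ x y z → x + (y + z) ≡ (x + z) + y
  swap = solve-∀

vandermonde : ∀ a b m → binomialConvolution a b m ≡ (a + b) C m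
vandermonde zero b m = begin
  binomialConvolution 0 b m                         ≡⟨ sumTo-unfoldˡ m _ ⟩
  1 * (b C m) + sumTo m (λ _ → 0)                   ≡⟨ cong (1 * (b C m) +_) (sumTo-zero m) ⟩
  1 * (b C m) + 0                                   ≡⟨ trans (+-identityʳ _) (*-identityˡ _) ⟩
  b C m                                             ∎
  where open ≡-Reasoning
vandermonde (suc a) b zero    = refl
vandermonde (suc a) b (suc m) = begin
  binomialConvolution (suc a) b (suc m)
    ≡⟨ binomialConvolution-pascal a b m ⟩
  binomialConvolution a b (suc m) + binomialConvolution a b m
    ≡⟨ cong₂ _+_ (vandermonde a b (suc m)) (vandermonde a b m) ⟩
  (a + b) C suc m + (a + b) C m
    ≡⟨ +-comm ((a + b) C suc m) ((a + b) C m) ⟩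
  (a + b) C m + (a + b) C suc m
    ≡⟨ nCk+nC[k+1]≡[n+1]C[k+1] (a + b) m ⟩
  suc (a + b) C suc m ∎
  where open ≡-Reasoning

-- Vandermonde's convolution for C(a + b, p), with the vanishing end terms k = 0, p removed.
carryTerm≡C : ∀ q a b → a < suc q → b < suc q → carryTerm (suc q) a b ≡ (a + b) C suc q
carryTerm≡C q a b a<p b<p = sym (begin
  (a + b) C p                         ≡⟨ sym (vandermonde a b p) ⟩
  binomialConvolution a b p           ≡⟨ sumTo-unfoldˡ p term ⟩
  term 0 + (carryTerm p a b + term p) ≡⟨ cong₂ (λ x y → x + (carryTerm p a b + y)) term0≡0 termp≡0 ⟩
  0 + (carryTerm p a b + 0)           ≡⟨ +-identityʳ _ ⟩
  carryTerm p a b                     ∎)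
  where
  open ≡-Reasoning
  p : ℕ
  p = suc q
  term : ℕ → ℕ
  term k = (a C k) * (b C (p ∸ k))
  term0≡0 : term 0 ≡ 0
  term0≡0 = trans (cong ((a C 0) *_) (k>n⇒nCk≡0 b<p)) (*-zeroʳ (a C 0))
  termp≡0 : term p ≡ 0
  termp≡0 = cong (_* (b C (p ∸ p))) (k>n⇒nCk≡0 a<p)

carrySum : ℕ → (ℕ → ℕ) → (ℕ → ℕ) → ℕ → ℕ
carrySum p a b t = sumTo t (λ i → carryTerm p (a i) (b i) * carryProd p a b i t)

carryProd-empty : ∀ p a b i → carryProd p a b i (suc i) ≡ 1
carryProd-empty p a b i =
  cong (λ n → prodTo n (λ m → (a (suc i + m) + b (suc i + m)) C (p ∸ 1))) (n∸n≡0 i)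

carryProd-extend : ∀ p a b i t → i < t →
  carryProd p a b i (suc t) ≡ carryProd p a b i t * ((a t + b t) C (p ∸ 1))
carryProd-extend p a b i t i<t =
  trans (cong (λ n → prodTo n factor) (+-∸-assoc 1 i<t))
        (cong (prodTo (t ∸ suc i) factor *_) (cong (λ j → (a j + b j) C (p ∸ 1)) (m+[n∸m]≡n i<t)))
  where
  factor : ℕ → ℕ
  factor m = (a (suc i + m) + b (suc i + m)) C (p ∸ 1)

carrySum-step : ∀ p a b t →
  carrySum p a b (suc t) ≡ carrySum p a b t * ((a t + b t) C (p ∸ 1)) + carryTerm p (a t) (b t)
carrySum-step p a b t = cong₂ _+_
  (trans (sumTo-cong t (λ i i<t → trans (cong (carryTerm p (a i) (b i) *_) (carryProd-extend p a b i t i<t))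
                                        (sym (*-assoc (carryTerm p (a i) (b i)) _ _))))
         (sumTo-distribʳ-* t _ _))
  (trans (cong (carryTerm p (a t) (b t) *_) (carryProd-empty p a b t)) (*-identityʳ _))

digitValue-unfoldˡ : ∀ p n (d : ℕ → ℕ) → digitValue p (suc n) d ≡ d 0 + digitValue p n (d ∘ suc) * p
digitValue-unfoldˡ p n d = trans (sumTo-unfoldˡ n _) (cong₂ _+_ (*-identityʳ (d 0))
  (trans (sumTo-cong n (λ i _ → reassoc (d (suc i)) p (p ^ i))) (sumTo-distribʳ-* n p _)))
  where
  reassoc : ∀ x y z → x * (y * z) ≡ x * z * y
  reassoc = solve-∀

digitValue-pad : ∀ p n (d : ℕ → ℕ) → d n ≡ 0 → digitValue p (suc n) d ≡ digitValue p n d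
digitValue-pad p n d dn≡0 = trans (cong (λ x → digitValue p n d + x * p ^ n) dn≡0) (+-identityʳ _)

m/n≡1 : ∀ {m n} .{{_ : NonZero n}} → n ≤ m → m < n + n → m / n ≡ 1
m/n≡1 {m} {n} n≤m m<2n = trans (m/n≡1+[m∸n]/n n≤m) (cong suc (m<n⇒m/n≡0 (m<n+o⇒m∸n<o m n m<2n)))

%-cong-+ˡ : ∀ {m n} o d .{{_ : NonZero d}} → m % d ≡ n % d → (o + m) % d ≡ (o + n) % d
%-cong-+ˡ {m} {n} o d m≡n = trans (%-distribˡ-+ o m d)
  (trans (cong (λ x → (o % d + x) % d) m≡n) (sym (%-distribˡ-+ o n d)))

%-cong-*ʳ : ∀ {m n} o d .{{_ : NonZero d}} → m % d ≡ n % d → (m * o) % d ≡ (n * o) % d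
%-cong-*ʳ {m} {n} o d m≡n = trans (%-distribˡ-* m o d)
  (trans (cong (λ x → (x * (o % d)) % d) m≡n) (sym (%-distribˡ-* n o d)))

module Carries (p : ℕ) .{{_ : NonZero p}} where

  carry : ℕ → (ℕ → ℕ) → (ℕ → ℕ) → ℕ → ℕ
  carry e a b zero    = e
  carry e a b (suc t) = (carry e a b t + a t + b t) / p

  carry-shift : ∀ e a b t → carry e a b (suc t) ≡ carry ((e + a 0 + b 0) / p) (a ∘ suc) (b ∘ suc) t
  carry-shift e a b zero    = refl
  carry-shift e a b (suc t) = cong (λ k → (k + a (suc t) + b (suc t)) / p) (carry-shift e a b t)

  carry≤1 : ∀ e a b t → e ≤ 1 → (∀ i → i < t → a i < p) → (∀ i → i < t → b i < p) → carry e a b t ≤ 1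
  carry≤1 e a b zero    e≤1 a<p b<p = e≤1
  carry≤1 e a b (suc t) e≤1 a<p b<p = s≤s⁻¹ (m<n*o⇒m/o<n {n = 2} (subst (carry e a b t + a t + b t <_) (cong (p +_) (sym (+-identityʳ p))) sum<2p))
    where
    k≤1 : carry e a b t ≤ 1
    k≤1 = carry≤1 e a b t e≤1 (λ i i<t → a<p i (m<n⇒m<1+n i<t)) (λ i i<t → b<p i (m<n⇒m<1+n i<t))
    sum<2p : carry e a b t + a t + b t < p + p
    sum<2p = +-mono-≤-< (≤-trans (+-monoˡ-≤ (a t) k≤1) (a<p t ≤-refl)) (b<p t ≤-refl)

  base-p-unique : ∀ x y u v → x < p → y < p → x + u * p ≡ y + v * p → x ≡ y × u ≡ v
  base-p-unique x y u v x<p y<p eq =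
    x≡y , *-cancelʳ-≡ u v p (+-cancelˡ-≡ x _ _ (trans eq (cong (_+ v * p) (sym x≡y))))
    where
    open ≡-Reasoning
    x≡y : x ≡ y
    x≡y = begin
      x               ≡⟨ sym (m<n⇒m%n≡m x<p) ⟩
      x % p           ≡⟨ sym ([m+kn]%n≡m%n x u p) ⟩
      (x + u * p) % p ≡⟨ cong (_% p) eq ⟩
      (y + v * p) % p ≡⟨ [m+kn]%n≡m%n y v p ⟩
      y % p           ≡⟨ m<n⇒m%n≡m y<p ⟩
      y               ∎

  lowest-digit : ∀ e a₀ b₀ c₀ α β γ → c₀ < p →
    e + (a₀ + α * p) + (b₀ + β * p) ≡ c₀ + γ * p →
    c₀ ≡ (e + a₀ + b₀) % p × (e + a₀ + b₀) / p + α + β ≡ γ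
  lowest-digit e a₀ b₀ c₀ α β γ c₀<p eq with base-p-unique _ c₀ _ γ (m%n<n s p) c₀<p split
    where
    open ≡-Reasoning
    s : ℕ
    s = e + a₀ + b₀
    regroup : ∀ r k x y z → r + (k + x + y) * z ≡ (r + k * z) + (x + y) * z
    regroup = solve-∀
    distribute : ∀ e a₀ b₀ x y z → (e + a₀ + b₀) + (x + y) * z ≡ e + (a₀ + x * z) + (b₀ + y * z)
    distribute = solve-∀
    split : s % p + (s / p + α + β) * p ≡ c₀ + γ * p
    split = begin
      s % p + (s / p + α + β) * p         ≡⟨ regroup (s % p) (s / p) α β p ⟩
      (s % p + s / p * p) + (α + β) * p   ≡⟨ cong (_+ (α + β) * p) (sym (m≡m%n+[m/n]*n s p)) ⟩
      s + (α + β) * p                     ≡⟨ distribute e a₀ b₀ α β p ⟩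
      e + (a₀ + α * p) + (b₀ + β * p)     ≡⟨ eq ⟩
      c₀ + γ * p                          ∎
  ... | low , high = sym low , high

  digits-of-sum : ∀ m e a b c → (∀ i → i < m → c i < p) →
    e + digitValue p m a + digitValue p m b ≡ digitValue p m c →
    ∀ t → t < m → c t ≡ (carry e a b t + a t + b t) % p
  digits-of-sum (suc m) e a b c c<p sum
    with lowest-digit e (a 0) (b 0) (c 0) _ _ _ (c<p 0 z<s)
           (trans (cong₂ (λ x y → e + x + y) (sym (digitValue-unfoldˡ p m a)) (sym (digitValue-unfoldˡ p m b)))
                  (trans sum (digitValue-unfoldˡ p m c)))
  ... | low , high = λ where
    zero    _         → low
    (suc t) (s≤s t<m) →
      trans (digits-of-sum m _ (a ∘ suc) (b ∘ suc) (c ∘ suc) (λ i i<m → c<p (suc i) (s≤s i<m)) high t t<m)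
            (cong (λ k → (k + a (suc t) + b (suc t)) % p) (sym (carry-shift e a b t)))

module PrimeBinomials (q : ℕ) (p-prime : Prime (suc q)) where

  p : ℕ
  p = suc q

  open Carries p

  1<p : 1 < p
  1<p = nonTrivial⇒n>1 p {{prime⇒nonTrivial p-prime}}

  p∤m! : ∀ m → m < p → ¬ p ∣ m !
  p∤m! zero    _   p∣1 = <⇒≢ 1<p (sym (∣1⇒≡1 p∣1))
  p∤m! (suc m) m<p p∣m! with euclidsLemma (suc m) (m !) p-prime p∣m!
  ... | inj₁ p∣1+m = <⇒≱ m<p (∣⇒≤ p∣1+m)
  ... | inj₂ p∣m!  = p∤m! m (<-trans (n<1+n m) m<p) p∣m!

  -- p divides (k+d)! = C(k+d, k) k! d!, but neither k! nor d!.
  p∣[k+d]Ck : ∀ k d → k < p → d < p → p ≤ k + d → p ∣ (k + d) C k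
  p∣[k+d]Ck k d k<p d<p p≤k+d with euclidsLemma ((k + d) C k) (k ! * (k + d ∸ k) !) p-prime p∣product
    where
    k≤k+d : k ≤ k + d
    k≤k+d = m≤m+n k d
    factorisation : ((k + d) C k) * (k ! * (k + d ∸ k) !) ≡ (k + d) !
    factorisation = trans (cong (_* (k ! * (k + d ∸ k) !)) (nCk≡n!/k![n-k]! k≤k+d))
                          (m/n*n≡m {{k !* (k + d ∸ k) !≢0}} (k![n∸k]!∣n! k≤k+d))
    p∣product : p ∣ ((k + d) C k) * (k ! * (k + d ∸ k) !)
    p∣product = subst (p ∣_) (sym factorisation) (∣-trans (m∣m*n (q !)) (m≤n⇒m!∣n! p≤k+d))
  ... | inj₁ p∣C = p∣C
  ... | inj₂ p∣k!d! with euclidsLemma (k !) ((k + d ∸ k) !) p-prime p∣k!d!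
  ...   | inj₁ p∣k! = ⊥-elim (p∤m! k k<p p∣k!)
  ...   | inj₂ p∣d! = ⊥-elim (p∤m! d d<p (subst (λ n → p ∣ n !) (m+n∸m≡n k d) p∣d!))

  [p+s]Cp%p≡1 : ∀ s → s < q → ((p + s) C p) % p ≡ 1
  [p+s]Cp%p≡1 zero    _ = trans (cong (λ n → (n C p) % p) (+-identityʳ p)) (trans (cong (_% p) (nCn≡1 p)) (m<n⇒m%n≡m 1<p))
  [p+s]Cp%p≡1 (suc s) 1+s<q = begin
    ((p + suc s) C p) % p           ≡⟨ cong (λ n → (n C p) % p) (+-suc p s) ⟩
    (suc (p + s) C p) % p           ≡⟨ cong (_% p) (sym (nCk+nC[k+1]≡[n+1]C[k+1] (p + s) q)) ⟩
    ((p + s) C q + (p + s) C p) % p ≡⟨ %-remove-+ˡ ((p + s) C p) p∣[p+s]Cq ⟩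
    ((p + s) C p) % p               ≡⟨ [p+s]Cp%p≡1 s (<-trans (n<1+n s) 1+s<q) ⟩
    1                               ∎
    where
    open ≡-Reasoning
    p∣[p+s]Cq : p ∣ (p + s) C q
    p∣[p+s]Cq = subst (λ n → p ∣ n C q) (+-suc q s)
      (p∣[k+d]Ck q (suc s) ≤-refl (<-trans 1+s<q (n<1+n q)) (subst (p ≤_) (sym (+-suc q s)) (s≤s (m≤m+n q s))))

  p∣nCq : ∀ n → q < n → n < p + q → p ∣ n C q
  p∣nCq n q<n n<p+q = subst (λ m → p ∣ m C q) (m+[n∸m]≡n q≤n)
    (p∣[k+d]Ck q (n ∸ q) ≤-refl (m<n+o⇒m∸n<o n q (subst (n <_) (sym (+-suc q q)) n<p+q))
               (subst (p ≤_) (sym (m+[n∸m]≡n q≤n)) q<n))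
    where
    q≤n : q ≤ n
    q≤n = <⇒≤ q<n

  -- The case ⌊n/p⌋ ≤ 1 of Lucas' theorem C(n, p) ≡ ⌊n/p⌋ (mod p).
  nCp%p≡n/p : ∀ n → n < p + q → (n C p) % p ≡ n / p
  nCp%p≡n/p n n<p+q with n <? p
  ... | yes n<p = trans (cong (_% p) (k>n⇒nCk≡0 n<p)) (sym (m<n⇒m/n≡0 n<p))
  ... | no  n≮p = begin
    (n C p) % p             ≡⟨ cong (λ m → (m C p) % p) (sym (m+[n∸m]≡n p≤n)) ⟩
    ((p + (n ∸ p)) C p) % p ≡⟨ [p+s]Cp%p≡1 (n ∸ p) (m<n+o⇒m∸n<o n p {q} {{>-nonZero q≥1}} n<p+q) ⟩
    1                       ≡⟨ sym (m/n≡1 p≤n (<-≤-trans n<p+q (+-monoʳ-≤ p (n≤1+n q)))) ⟩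
    n / p                   ∎
    where
    open ≡-Reasoning
    p≤n : p ≤ n
    p≤n = ≮⇒≥ n≮p
    q≥1 : 1 ≤ q
    q≥1 = s≤s⁻¹ 1<p

  [1+n]/p%p≡[nCp+nCq]%p : ∀ n → n < p + q → suc n / p % p ≡ (n C p + n C q) % p
  [1+n]/p%p≡[nCp+nCq]%p n n<p+q with <-cmp n q
  ... | tri< n<q _ _ = begin
    suc n / p % p       ≡⟨ cong (_% p) (m<n⇒m/n≡0 (s≤s n<q)) ⟩
    0                   ≡⟨ cong (_% p) (sym (cong₂ _+_ (k>n⇒nCk≡0 (<-trans n<q (n<1+n q))) (k>n⇒nCk≡0 n<q))) ⟩
    (n C p + n C q) % p ∎
    where open ≡-Reasoning
  ... | tri≈ _ refl _ = begin
    p / p % p           ≡⟨ cong (_% p) (n/n≡1 p) ⟩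
    1 % p               ≡⟨ cong (_% p) (sym (cong₂ _+_ (k>n⇒nCk≡0 (n<1+n q)) (nCn≡1 q))) ⟩
    (q C p + q C q) % p ∎
    where open ≡-Reasoning
  ... | tri> _ _ q<n = begin
    suc n / p % p       ≡⟨ cong (_% p) (trans (m/n≡1 (m≤n⇒m≤1+n q<n) (≤-<-trans n<p+q p+q<p+p))
                                              (sym (m/n≡1 q<n (<-trans n<p+q p+q<p+p)))) ⟩
    n / p % p           ≡⟨ cong (_% p) (sym (nCp%p≡n/p n n<p+q)) ⟩
    (n C p) % p % p     ≡⟨ m%n%n≡m%n (n C p) p ⟩
    (n C p) % p         ≡⟨ sym (%-remove-+ʳ (n C p) (p∣nCq n q<n n<p+q)) ⟩
    (n C p + n C q) % p ∎
    where
    open ≡-Reasoning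
    p+q<p+p : p + q < p + p
    p+q<p+p = +-monoʳ-< p (n<1+n q)

  carry-step-mod : ∀ e n → e ≤ 1 → n < p + q → (e + n) / p % p ≡ (n C p + e * (n C q)) % p
  carry-step-mod zero n _ n<p+q = begin
    n / p % p       ≡⟨ cong (_% p) (sym (nCp%p≡n/p n n<p+q)) ⟩
    (n C p) % p % p ≡⟨ m%n%n≡m%n (n C p) p ⟩
    (n C p) % p     ≡⟨ cong (_% p) (sym (+-identityʳ (n C p))) ⟩
    (n C p + 0) % p ∎
    where open ≡-Reasoning
  carry-step-mod (suc zero) n _ n<p+q =
    trans ([1+n]/p%p≡[nCp+nCq]%p n n<p+q) (cong (λ x → (n C p + x) % p) (sym (*-identityˡ (n C q))))
  carry-step-mod (suc (suc e)) n (s≤s ()) _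

  carry≡carrySum : ∀ a b t → (∀ i → i < t → a i < p) → (∀ i → i < t → b i < p) →
    carry 0 a b t % p ≡ carrySum p a b t % p
  carry≡carrySum a b zero    _   _   = refl
  carry≡carrySum a b (suc t) a<p b<p = begin
    carry 0 a b (suc t) % p      ≡⟨ cong (λ x → x / p % p) (+-assoc κ (a t) (b t)) ⟩
    (κ + n) / p % p              ≡⟨ carry-step-mod κ n (carry≤1 0 a b t z≤n a<p′ b<p′) n<p+q ⟩
    (n C p + κ * (n C q)) % p    ≡⟨ %-cong-+ˡ (n C p) p (%-cong-*ʳ {κ} {σ} (n C q) p (carry≡carrySum a b t a<p′ b<p′)) ⟩
    (n C p + σ * (n C q)) % p    ≡⟨ cong (_% p) (+-comm (n C p) (σ * (n C q))) ⟩
    (σ * (n C q) + n C p) % p    ≡⟨ cong (λ x → (σ * (n C q) + x) % p)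
                                         (sym (carryTerm≡C q (a t) (b t) (a<p t ≤-refl) (b<p t ≤-refl))) ⟩
    (σ * (n C q) + carryTerm p (a t) (b t)) % p ≡⟨ cong (_% p) (sym (carrySum-step p a b t)) ⟩
    carrySum p a b (suc t) % p   ∎
    where
    open ≡-Reasoning
    κ σ n : ℕ
    κ = carry 0 a b t
    σ = carrySum p a b t
    n = a t + b t
    a<p′ : ∀ i → i < t → a i < p
    a<p′ i i<t = a<p i (m<n⇒m<1+n i<t)
    b<p′ : ∀ i → i < t → b i < p
    b<p′ i i<t = b<p i (m<n⇒m<1+n i<t)
    n<p+q : n < p + q
    n<p+q = s≤s (+-mono-≤ (s≤s⁻¹ (a<p t ≤-refl)) (s≤s⁻¹ (b<p t ≤-refl)))

theorem2p1 : (p r : ℕ) → .{{_ : NonZero p}} → Prime p → 1 ≤ r →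
    (a b c : ℕ → ℕ) →
    (∀ i → i ≤ r → a i < p) → (∀ i → i ≤ r → b i < p) →
    a (suc r) ≡ 0 → b (suc r) ≡ 0 →
    (∀ i → i ≤ suc r → c i < p) →
    digitValue p (suc r) a + digitValue p (suc r) b ≡ digitValue p (suc (suc r)) c →
    (c 0 % p ≡ (a 0 + b 0) % p)
    × (∀ t → 1 ≤ t → t ≤ suc r → c t % p ≡ rhs p a b t % p)
theorem2p1 zero    r p-prime _ a b c a<p b<p a[r+1]≡0 b[r+1]≡0 c<p sum = ⊥-elim (¬prime[0] p-prime)
-- The formula also holds for t = 0.
theorem2p1 (suc q) r p-prime _ a b c a<p b<p a[r+1]≡0 b[r+1]≡0 c<p sum = lowest , higher
  where
  open PrimeBinomials q p-prime
  open Carries p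
  digit : ∀ t → t ≤ suc r → c t ≡ (carry 0 a b t + a t + b t) % p
  digit t t≤1+r = digits-of-sum (suc (suc r)) 0 a b c (λ i → c<p i ∘ s≤s⁻¹)
    (trans (cong₂ _+_ (digitValue-pad p (suc r) a a[r+1]≡0) (digitValue-pad p (suc r) b b[r+1]≡0)) sum)
    t (s≤s t≤1+r)
  lowest : c 0 % p ≡ (a 0 + b 0) % p
  lowest = trans (cong (_% p) (digit 0 z≤n)) (m%n%n≡m%n (a 0 + b 0) p)
  higher : ∀ t → 1 ≤ t → t ≤ suc r → c t % p ≡ rhs p a b t % p
  higher t _ t≤1+r = begin
    c t % p                       ≡⟨ cong (_% p) (digit t t≤1+r) ⟩
    (κ + a t + b t) % p % p       ≡⟨ m%n%n≡m%n (κ + a t + b t) p ⟩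
    (κ + a t + b t) % p           ≡⟨ cong (_% p) (trans (+-assoc κ (a t) (b t)) (+-comm κ (a t + b t))) ⟩
    (a t + b t + κ) % p           ≡⟨ %-cong-+ˡ (a t + b t) p (carry≡carrySum a b t (below a<p) (below b<p)) ⟩
    rhs p a b t % p               ∎
    where
    open ≡-Reasoning
    κ : ℕ
    κ = carry 0 a b t
    below : {d : ℕ → ℕ} → (∀ i → i ≤ r → d i < p) → ∀ i → i < t → d i < p
    below d<p i i<t = d<p i (s≤s⁻¹ (≤-trans i<t t≤1+r))
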